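{- Let $K$ be any field and $\det_3=\sum_{\sigma\in\Sigma_3}\operatorname{sgn}(\sigma)\,e_{\sigma(1)}\otimes e_{\sigma(2)}\otimes e_{\sigma(3)}\in K^3\otimes K^3\otimes K^3$. Then $\operatorname{brk}(\det_3)\le\operatorname{trk}(\det_3)\le 5$.
   Context: $e_1,e_2,e_3$ is the standard basis of $K^3$. A simple tensor is one of the form $v_1\otimes v_2\otimes v_3$; $\operatorname{trk}(T)$ is the least number of simple tensors summing to $T$; with $\mathcal{S}_r$ the set of tensors of tensor rank $\le r$, $\operatorname{brk}(T)$ is the least $r$ with $T$ in the Zariski closure of $\mathcal{S}_r$. -}

module Defs where

open import Level using (Level; _⊔_) renaming (suc to lsuc)
open import Algebra.Bundles using (CommutativeRing)
open import Data.Nat using (ℕ)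
open import Data.Fin using (Fin; zero; suc)
open import Data.Product using (Σ; _×_; ∃; _,_)
open import Data.Vec using (Vec; []; _∷_)
open import Relation.Nullary using (¬_)

record Field (c ℓ : Level) : Set (lsuc (c ⊔ ℓ)) where
  field
    commutativeRing : CommutativeRing c ℓ
  open CommutativeRing commutativeRing public
  field
    0≉1     : ¬ (0# ≈ 1#)
    inverse : ∀ x → ¬ (x ≈ 0#) → Σ Carrier λ y → x * y ≈ 1#

module _ {c ℓ : Level} (K : Field c ℓ) where
  open Field K

  K³ : Set c
  K³ = Fin 3 → Carrier

  -- tensors in K^3 ⊗ K^3 ⊗ K^3, as coordinate arrays w.r.t. e_i ⊗ e_j ⊗ e_k
  Tensor : Set c
  Tensor = Fin 3 → Fin 3 → Fin 3 → Carrier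

  _≈ᵀ_ : Tensor → Tensor → Set ℓ
  S ≈ᵀ T = ∀ i j k → S i j k ≈ T i j k

  zeroᵀ : Tensor
  zeroᵀ _ _ _ = 0#

  _+ᵀ_ : Tensor → Tensor → Tensor
  (S +ᵀ T) i j k = S i j k + T i j k

  _⊗_⊗_ : K³ → K³ → K³ → Tensor
  (u ⊗ v ⊗ w) i j k = u i * v j * w k

  sumSimple : ∀ {r} → Vec (K³ × K³ × K³) r → Tensor
  sumSimple []                    = zeroᵀ
  sumSimple ((u , v , w) ∷ rest)  = (u ⊗ v ⊗ w) +ᵀ sumSimple rest

  -- T ∈ 𝒮_r : T is a sum of r simple tensors (simple tensors may be zero,
  -- so this is exactly "tensor rank ≤ r", i.e. trk(T) ≤ r)
  RankLe : ℕ → Tensor → Set (c ⊔ ℓ)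
  RankLe r T = ∃ λ (ts : Vec (K³ × K³ × K³) r) → sumSimple ts ≈ᵀ T

  data Poly : Set c where
    var  : Fin 3 → Fin 3 → Fin 3 → Poly
    con  : Carrier → Poly
    _⊕_  : Poly → Poly → Poly
    _⊛_  : Poly → Poly → Poly

  eval : Poly → Tensor → Carrier
  eval (var i j k) T = T i j k
  eval (con a)     T = a
  eval (p ⊕ q)     T = eval p T + eval q T
  eval (p ⊛ q)     T = eval p T * eval q T

  InZariskiClosure : (Tensor → Set (c ⊔ ℓ)) → Tensor → Set (c ⊔ ℓ)
  InZariskiClosure 𝒮 T =
    (p : Poly) → (∀ S → 𝒮 S → eval p S ≈ 0#) → eval p T ≈ 0#

  BorderRankLe : ℕ → Tensor → Set (c ⊔ ℓ)
  BorderRankLe r T = InZariskiClosure (RankLe r) T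

  -- det₃ = Σ_{σ ∈ Σ₃} sgn(σ) e_{σ(1)} ⊗ e_{σ(2)} ⊗ e_{σ(3)}
  -- (indices 0,1,2 stand for 1,2,3)
  det₃ : Tensor
  det₃ zero          (suc zero)    (suc (suc zero)) = 1#
  det₃ (suc zero)    (suc (suc zero)) zero          = 1#
  det₃ (suc (suc zero)) zero       (suc zero)       = 1#
  det₃ zero          (suc (suc zero)) (suc zero)    = - 1#
  det₃ (suc (suc zero)) (suc zero) zero             = - 1#
  det₃ (suc zero)    zero          (suc (suc zero)) = - 1#
  det₃ _             _             _                = 0#

-- det₃ is the sum of five simple tensors with integer coefficients,
--   (e₁+e₂)⊗(e₁+e₂+e₃)⊗e₁ − (e₁+e₂+e₃)⊗(e₁+e₂)⊗(e₁+e₃) − e₁⊗(e₁+e₃)⊗(e₁+e₂)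
--   + (e₁+e₃)⊗e₁⊗(e₁+e₂+e₃) + (2e₁+e₂+e₃)⊗e₂⊗e₃ .
-- This identity is checked once over ℤ by evaluation and then transported to an
-- arbitrary field along the canonical ring map ℤ → K, which preserves sums and
-- products. Border rank is at most rank because a set lies in its Zariski closure.

module Submission where

open import Defs
open import Level using (Level)
open import Algebra.Bundles using (Ring)
import Algebra.Properties.CommutativeSemigroup as CommutativeSemigroupProperties
import Algebra.Properties.Ring as RingProperties
import Algebra.Properties.Semiring.Mult as SemiringMult
open import Data.Fin using (Fin; zero; suc)
open import Data.Fin.Properties using (all?)
open import Data.Nat as ℕ using (ℕ)
open import Data.Product using (_×_; _,_)
open import Data.Vec as Vec using (Vec; []; _∷_)
import Data.Vec.Functional as Vector
open import Function using (_∘_)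
open import Relation.Binary.Definitions using (Decidable)
open import Relation.Binary.PropositionalEquality using (_≡_; cong)
import Relation.Binary.Reasoning.Setoid as SetoidReasoning
open import Relation.Nullary.Decidable using (from-yes)

module DifferenceLaws {c ℓ : Level} (R : Ring c ℓ) where
  open Ring R
  open RingProperties R
  open CommutativeSemigroupProperties +-commutativeSemigroup using (interchange)
  open SetoidReasoning setoid

  [a+b]-[c+d]≈[a-c]+[b-d] : ∀ a b c d → (a + b) - (c + d) ≈ (a - c) + (b - d)
  [a+b]-[c+d]≈[a-c]+[b-d] a b c d = begin
    (a + b) - (c + d)      ≈⟨ +-congˡ (-‿+-comm c d) ⟨
    (a + b) + (- c + - d)  ≈⟨ interchange a b (- c) (- d) ⟩
    (a - c) + (b - d)      ∎

  a+d≈c+b⇒a-b≈c-d : ∀ {a b c d} → a + d ≈ c + b → a - b ≈ c - d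
  a+d≈c+b⇒a-b≈c-d {a} {b} {c} {d} a+d≈c+b = begin
    a - b                  ≈⟨ +-identityʳ (a - b) ⟨
    (a - b) + 0#           ≈⟨ +-congˡ (-‿inverseʳ d) ⟨
    (a - b) + (d - d)      ≈⟨ [a+b]-[c+d]≈[a-c]+[b-d] a d b d ⟨
    (a + d) - (b + d)      ≈⟨ +-cong a+d≈c+b (-‿cong (+-comm b d)) ⟩
    (c + b) - (d + b)      ≈⟨ [a+b]-[c+d]≈[a-c]+[b-d] c b d b ⟩
    (c - d) + (b - b)      ≈⟨ +-congˡ (-‿inverseʳ b) ⟩
    (c - d) + 0#           ≈⟨ +-identityʳ (c - d) ⟩
    c - d                  ∎

  [a-b][c-d]≈[ac+bd]-[ad+bc] : ∀ a b c d →
    (a - b) * (c - d) ≈ (a * c + b * d) - (a * d + b * c)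
  [a-b][c-d]≈[ac+bd]-[ad+bc] a b c d = begin
    (a - b) * (c - d)                      ≈⟨ x[y-z]≈xy-xz (a - b) c d ⟩
    (a - b) * c - (a - b) * d              ≈⟨ +-cong ([y-z]x≈yx-zx c a b) (-‿cong ([y-z]x≈yx-zx d a b)) ⟩
    (a * c - b * c) - (a * d - b * d)      ≈⟨ +-congˡ (⁻¹-anti-homo‿- (a * d) (b * d)) ⟩
    (a * c - b * c) + (b * d - a * d)      ≈⟨ interchange (a * c) (- (b * c)) (b * d) (- (a * d)) ⟩
    (a * c + b * d) + (- (b * c) - a * d)  ≈⟨ +-congˡ (-‿+-comm (b * c) (a * d)) ⟩
    (a * c + b * d) - (b * c + a * d)      ≈⟨ +-congˡ (-‿cong (+-comm (b * c) (a * d))) ⟩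
    (a * c + b * d) - (a * d + b * c)      ∎

-- (p , n) stands for the integer p − n.
Diff : Set
Diff = ℕ × ℕ

infixl 6 _+ᵈ_
infixl 7 _*ᵈ_
infix  4 _≃ᵈ_ _≃ᵈ?_

_+ᵈ_ : Diff → Diff → Diff
(p , n) +ᵈ (p′ , n′) = p ℕ.+ p′ , n ℕ.+ n′

_*ᵈ_ : Diff → Diff → Diff
(p , n) *ᵈ (p′ , n′) = p ℕ.* p′ ℕ.+ n ℕ.* n′ , p ℕ.* n′ ℕ.+ n ℕ.* p′

_≃ᵈ_ : Diff → Diff → Set
(p , n) ≃ᵈ (p′ , n′) = p ℕ.+ n′ ≡ p′ ℕ.+ n

_≃ᵈ?_ : Decidable _≃ᵈ_
(p , n) ≃ᵈ? (p′ , n′) = p ℕ.+ n′ ℕ.≟ p′ ℕ.+ n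

0ᵈ 1ᵈ -1ᵈ 2ᵈ : Diff
0ᵈ  = 0 , 0
1ᵈ  = 1 , 0
-1ᵈ = 0 , 1
2ᵈ  = 2 , 0

module Interpretation {c ℓ : Level} (R : Ring c ℓ) where
  open Ring R
  open RingProperties R using (-0#≈0#)
  open SemiringMult semiring using (×-homo-+; ×1-homo-*) renaming (_×_ to _·_)
  open DifferenceLaws R
  open SetoidReasoning setoid

  ι : ℕ → Carrier
  ι n = n · 1#

  ⟦_⟧ : Diff → Carrier
  ⟦ p , n ⟧ = ι p - ι n

  ⟦⟧-cong : ∀ {x y} → x ≃ᵈ y → ⟦ x ⟧ ≈ ⟦ y ⟧
  ⟦⟧-cong {p , n} {p′ , n′} p+n′≡p′+n = a+d≈c+b⇒a-b≈c-d (begin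
    ι p + ι n′       ≈⟨ ×-homo-+ 1# p n′ ⟨
    ι (p ℕ.+ n′)     ≡⟨ cong ι p+n′≡p′+n ⟩
    ι (p′ ℕ.+ n)     ≈⟨ ×-homo-+ 1# p′ n ⟩
    ι p′ + ι n       ∎)

  ⟦⟧-homo-+ : ∀ x y → ⟦ x +ᵈ y ⟧ ≈ ⟦ x ⟧ + ⟦ y ⟧
  ⟦⟧-homo-+ (p , n) (p′ , n′) = begin
    ι (p ℕ.+ p′) - ι (n ℕ.+ n′)      ≈⟨ +-cong (×-homo-+ 1# p p′) (-‿cong (×-homo-+ 1# n n′)) ⟩
    (ι p + ι p′) - (ι n + ι n′)      ≈⟨ [a+b]-[c+d]≈[a-c]+[b-d] (ι p) (ι p′) (ι n) (ι n′) ⟩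
    (ι p - ι n) + (ι p′ - ι n′)      ∎

  ⟦⟧-homo-* : ∀ x y → ⟦ x *ᵈ y ⟧ ≈ ⟦ x ⟧ * ⟦ y ⟧
  ⟦⟧-homo-* (p , n) (p′ , n′) = begin
    ι (p ℕ.* p′ ℕ.+ n ℕ.* n′) - ι (p ℕ.* n′ ℕ.+ n ℕ.* p′)
      ≈⟨ +-cong (ι-homo-+* p p′ n n′) (-‿cong (ι-homo-+* p n′ n p′)) ⟩
    (ι p * ι p′ + ι n * ι n′) - (ι p * ι n′ + ι n * ι p′)
      ≈⟨ [a-b][c-d]≈[ac+bd]-[ad+bc] (ι p) (ι n) (ι p′) (ι n′) ⟨
    (ι p - ι n) * (ι p′ - ι n′)  ∎
    where
    ι-homo-+* : ∀ a b c d → ι (a ℕ.* b ℕ.+ c ℕ.* d) ≈ ι a * ι b + ι c * ι d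
    ι-homo-+* a b c d =
      trans (×-homo-+ 1# (a ℕ.* b) (c ℕ.* d)) (+-cong (×1-homo-* a b) (×1-homo-* c d))

  ⟦0ᵈ⟧ : ⟦ 0ᵈ ⟧ ≈ 0#
  ⟦0ᵈ⟧ = -‿inverseʳ 0#

  ⟦1ᵈ⟧ : ⟦ 1ᵈ ⟧ ≈ 1#
  ⟦1ᵈ⟧ = trans (+-cong (+-identityʳ 1#) -0#≈0#) (+-identityʳ 1#)

  ⟦-1ᵈ⟧ : ⟦ -1ᵈ ⟧ ≈ - 1#
  ⟦-1ᵈ⟧ = trans (+-identityˡ (- (1# + 0#))) (-‿cong (+-identityʳ 1#))

Diff³ : Set
Diff³ = Fin 3 → Diff

sumSimpleᵈ : ∀ {r} → Vec (Diff³ × Diff³ × Diff³) r → Fin 3 → Fin 3 → Fin 3 → Diff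
sumSimpleᵈ []                   i j k = 0ᵈ
sumSimpleᵈ ((u , v , w) ∷ uvws) i j k = u i *ᵈ v j *ᵈ w k +ᵈ sumSimpleᵈ uvws i j k

det₃ᵈ : Fin 3 → Fin 3 → Fin 3 → Diff
det₃ᵈ zero             (suc zero)       (suc (suc zero)) = 1ᵈ
det₃ᵈ (suc zero)       (suc (suc zero)) zero             = 1ᵈ
det₃ᵈ (suc (suc zero)) zero             (suc zero)       = 1ᵈ
det₃ᵈ zero             (suc (suc zero)) (suc zero)       = -1ᵈ
det₃ᵈ (suc (suc zero)) (suc zero)       zero             = -1ᵈ
det₃ᵈ (suc zero)       zero             (suc (suc zero)) = -1ᵈ
det₃ᵈ _                _                _                = 0ᵈ

det₃ᵈ-decomposition : Vec (Diff³ × Diff³ × Diff³) 5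
det₃ᵈ-decomposition =
    ( ⟨  1ᵈ ,  1ᵈ ,  0ᵈ ⟩ , ⟨ 1ᵈ , 1ᵈ , 1ᵈ ⟩ , ⟨ 1ᵈ , 0ᵈ , 0ᵈ ⟩ )
  ∷ ( ⟨ -1ᵈ , -1ᵈ , -1ᵈ ⟩ , ⟨ 1ᵈ , 1ᵈ , 0ᵈ ⟩ , ⟨ 1ᵈ , 0ᵈ , 1ᵈ ⟩ )
  ∷ ( ⟨ -1ᵈ ,  0ᵈ ,  0ᵈ ⟩ , ⟨ 1ᵈ , 0ᵈ , 1ᵈ ⟩ , ⟨ 1ᵈ , 1ᵈ , 0ᵈ ⟩ )
  ∷ ( ⟨  1ᵈ ,  0ᵈ ,  1ᵈ ⟩ , ⟨ 1ᵈ , 0ᵈ , 0ᵈ ⟩ , ⟨ 1ᵈ , 1ᵈ , 1ᵈ ⟩ )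
  ∷ ( ⟨  2ᵈ ,  1ᵈ ,  1ᵈ ⟩ , ⟨ 0ᵈ , 1ᵈ , 0ᵈ ⟩ , ⟨ 0ᵈ , 0ᵈ , 1ᵈ ⟩ )
  ∷ []
  where
  ⟨_,_,_⟩ : Diff → Diff → Diff → Diff³
  ⟨ x , y , z ⟩ = x Vector.∷ y Vector.∷ z Vector.∷ Vector.[]

sumSimpleᵈ-det₃ᵈ-decomposition : ∀ i j k → sumSimpleᵈ det₃ᵈ-decomposition i j k ≃ᵈ det₃ᵈ i j k
sumSimpleᵈ-det₃ᵈ-decomposition = from-yes (all? λ i → all? λ j → all? λ k →
  sumSimpleᵈ det₃ᵈ-decomposition i j k ≃ᵈ? det₃ᵈ i j k)

module _ {c ℓ : Level} (K : Field c ℓ) where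
  open Field K
  open Interpretation ring

  InZariskiClosure-extensive : ∀ {𝒮 T} → 𝒮 T → InZariskiClosure K 𝒮 T
  InZariskiClosure-extensive {T = T} T∈𝒮 p p-vanishes = p-vanishes T T∈𝒮

  interpretTriples : ∀ {r} → Vec (Diff³ × Diff³ × Diff³) r → Vec (K³ K × K³ K × K³ K) r
  interpretTriples = Vec.map λ (u , v , w) → ⟦_⟧ ∘ u , ⟦_⟧ ∘ v , ⟦_⟧ ∘ w

  sumSimple-interpretTriples : ∀ {r} (uvws : Vec (Diff³ × Diff³ × Diff³) r) i j k →
    sumSimple K (interpretTriples uvws) i j k ≈ ⟦ sumSimpleᵈ uvws i j k ⟧
  sumSimple-interpretTriples [] i j k = sym ⟦0ᵈ⟧
  sumSimple-interpretTriples ((u , v , w) ∷ uvws) i j k = sym (begin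
    ⟦ u i *ᵈ v j *ᵈ w k +ᵈ sumSimpleᵈ uvws i j k ⟧
      ≈⟨ ⟦⟧-homo-+ (u i *ᵈ v j *ᵈ w k) (sumSimpleᵈ uvws i j k) ⟩
    ⟦ u i *ᵈ v j *ᵈ w k ⟧ + ⟦ sumSimpleᵈ uvws i j k ⟧
      ≈⟨ +-cong (trans (⟦⟧-homo-* (u i *ᵈ v j) (w k)) (*-congʳ (⟦⟧-homo-* (u i) (v j))))
                (sym (sumSimple-interpretTriples uvws i j k)) ⟩
    ⟦ u i ⟧ * ⟦ v j ⟧ * ⟦ w k ⟧ + sumSimple K (interpretTriples uvws) i j k  ∎)
    where open SetoidReasoning setoid

  ⟦det₃ᵈ⟧≈det₃ : ∀ i j k → ⟦ det₃ᵈ i j k ⟧ ≈ det₃ K i j k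
  ⟦det₃ᵈ⟧≈det₃ zero             (suc zero)       (suc (suc zero)) = ⟦1ᵈ⟧
  ⟦det₃ᵈ⟧≈det₃ (suc zero)       (suc (suc zero)) zero             = ⟦1ᵈ⟧
  ⟦det₃ᵈ⟧≈det₃ (suc (suc zero)) zero             (suc zero)       = ⟦1ᵈ⟧
  ⟦det₃ᵈ⟧≈det₃ zero             (suc (suc zero)) (suc zero)       = ⟦-1ᵈ⟧
  ⟦det₃ᵈ⟧≈det₃ (suc (suc zero)) (suc zero)       zero             = ⟦-1ᵈ⟧
  ⟦det₃ᵈ⟧≈det₃ (suc zero)       zero             (suc (suc zero)) = ⟦-1ᵈ⟧
  ⟦det₃ᵈ⟧≈det₃ zero             zero             _                = ⟦0ᵈ⟧
  ⟦det₃ᵈ⟧≈det₃ zero             (suc zero)       zero             = ⟦0ᵈ⟧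
  ⟦det₃ᵈ⟧≈det₃ zero             (suc zero)       (suc zero)       = ⟦0ᵈ⟧
  ⟦det₃ᵈ⟧≈det₃ zero             (suc (suc zero)) zero             = ⟦0ᵈ⟧
  ⟦det₃ᵈ⟧≈det₃ zero             (suc (suc zero)) (suc (suc zero)) = ⟦0ᵈ⟧
  ⟦det₃ᵈ⟧≈det₃ (suc zero)       zero             zero             = ⟦0ᵈ⟧
  ⟦det₃ᵈ⟧≈det₃ (suc zero)       zero             (suc zero)       = ⟦0ᵈ⟧
  ⟦det₃ᵈ⟧≈det₃ (suc zero)       (suc zero)       _                = ⟦0ᵈ⟧
  ⟦det₃ᵈ⟧≈det₃ (suc zero)       (suc (suc zero)) (suc _)          = ⟦0ᵈ⟧
  ⟦det₃ᵈ⟧≈det₃ (suc (suc zero)) zero             zero             = ⟦0ᵈ⟧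
  ⟦det₃ᵈ⟧≈det₃ (suc (suc zero)) zero             (suc (suc zero)) = ⟦0ᵈ⟧
  ⟦det₃ᵈ⟧≈det₃ (suc (suc zero)) (suc zero)       (suc _)          = ⟦0ᵈ⟧
  ⟦det₃ᵈ⟧≈det₃ (suc (suc zero)) (suc (suc zero)) _                = ⟦0ᵈ⟧

  det₃-rank≤5 : RankLe K 5 (det₃ K)
  det₃-rank≤5 = interpretTriples det₃ᵈ-decomposition , λ i j k → begin
    sumSimple K (interpretTriples det₃ᵈ-decomposition) i j k
      ≈⟨ sumSimple-interpretTriples det₃ᵈ-decomposition i j k ⟩
    ⟦ sumSimpleᵈ det₃ᵈ-decomposition i j k ⟧
      ≈⟨ ⟦⟧-cong {y = det₃ᵈ i j k} (sumSimpleᵈ-det₃ᵈ-decomposition i j k) ⟩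
    ⟦ det₃ᵈ i j k ⟧
      ≈⟨ ⟦det₃ᵈ⟧≈det₃ i j k ⟩
    det₃ K i j k  ∎
    where open SetoidReasoning setoid

corollary3p1 : {c ℓ : Level} (K : Field c ℓ) →
    ((r : ℕ) → RankLe K r (det₃ K) → BorderRankLe K r (det₃ K))
    × RankLe K 5 (det₃ K)
corollary3p1 K = (λ r → InZariskiClosure-extensive K) , det₃-rank≤5 K
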